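{- Let $a$ be an odd integer with $a>2$ and $S=\langle a,a+1,a+2\rangle$. Then $\operatorname{Ap}(S,\operatorname{UBetti}(S))=\left\{\lambda a+\mu(a+1)+\eta(a+2):\mu\in\{0,1\},\ \lambda\in\{0,\dots,\tfrac{a-1}{2}+1-\mu\},\ \eta\in\{0,\dots,\tfrac{a-1}{2}-\mu\}\right\}.$
   Context: $\mathbb{N}=\{0,1,2,\dots\}$; $S=\langle a,a+1,a+2\rangle=\{\alpha_1a+\alpha_2(a+1)+\alpha_3(a+2):\alpha_i\in\mathbb{N}\}$. For $r\in S$, $\operatorname{F}(r,S)=\{\alpha\in\mathbb{N}^3:\alpha_1a+\alpha_2(a+1)+\alpha_3(a+2)=r\}$, $|\alpha|=\alpha_1+\alpha_2+\alpha_3$, $\operatorname{L}(r,S)=\{|\alpha|:\alpha\in\operatorname{F}(r,S)\}$, $\operatorname{ULF}(S)=\{r\in S:|\operatorname{L}(r,S)|=1\}$. For $r\in S$, $\nabla_r$ is the graph on $\operatorname{F}(r,S)$ where two vertices are adjacent iff their dot product is nonzero; $r$ is a Betti element if $\nabla_r$ is disconnected; $\operatorname{UBetti}(S)$ is the set of Betti elements of $S$ not in $\operatorname{ULF}(S)$. For $X\subseteq S\setminus\{0\}$, $\operatorname{Ap}(S,X)=\{s\in S:s-x\notin S\text{ for all }x\in X\}$. -}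

module Defs where

open import Data.Nat using (ℕ; zero; suc; _+_; _*_; _≡ᵇ_)
open import Data.Product using (Σ; ∃; _×_; _,_)
open import Data.Empty using (⊥)
open import Relation.Nullary using (¬_)
open import Relation.Binary.PropositionalEquality using (_≡_)
open import Function.Bundles using (_⇔_)

-- Throughout, the parameter a fixes S = ⟨a, a+1, a+2⟩.

ℕ³ : Set
ℕ³ = ℕ × ℕ × ℕ

eval : ℕ → ℕ³ → ℕ
eval a (α₁ , α₂ , α₃) = α₁ * a + α₂ * (a + 1) + α₃ * (a + 2)

len : ℕ³ → ℕ
len (α₁ , α₂ , α₃) = α₁ + α₂ + α₃

dot : ℕ³ → ℕ³ → ℕ
dot (α₁ , α₂ , α₃) (β₁ , β₂ , β₃) = α₁ * β₁ + α₂ * β₂ + α₃ * β₃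

InS : ℕ → ℕ → Set
InS a r = ∃ λ (α : ℕ³) → eval a α ≡ r

IsFact : ℕ → ℕ → ℕ³ → Set
IsFact a r α = eval a α ≡ r

InL : ℕ → ℕ → ℕ → Set
InL a r n = ∃ λ (α : ℕ³) → IsFact a r α × len α ≡ n

InULF : ℕ → ℕ → Set
InULF a r = InS a r × ∃ λ ℓ → (∀ n → InL a r n ⇔ (n ≡ ℓ))

Adj : ℕ³ → ℕ³ → Set
Adj α β = ¬ (dot α β ≡ 0)

data Walk (a r : ℕ) : ℕ³ → ℕ³ → Set where
  here : ∀ {α} → Walk a r α α
  step : ∀ {α β γ} → IsFact a r β → Adj α β → Walk a r β γ → Walk a r α γ

Connected : ℕ → ℕ → Set
Connected a r = ∀ α β → IsFact a r α → IsFact a r β → Walk a r α β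

IsBetti : ℕ → ℕ → Set
IsBetti a r = InS a r × ¬ Connected a r

InUBetti : ℕ → ℕ → Set
InUBetti a r = IsBetti a r × ¬ InULF a r

-- s ∈ Ap(S, X) with X given as a predicate on ℕ:
-- s ∈ S and for all x ∈ X, s - x ∉ S (s - x ∈ S means s = x + t, t ∈ S)
InAp : ℕ → (ℕ → Set) → ℕ → Set
InAp a X s = InS a s × (∀ x → X x → ¬ (∃ λ t → InS a t × s ≡ x + t))

{-# OPTIONS --safe #-}

-- Write a = 2k + 1. A factorisation α of s has length |α| and excess α₂ + 2α₃, with
-- s = |α| a + excess; mirroring α gives the coexcess α₂ + 2α₁, with s + coexcess = |α| (a + 2).
-- So a factorisation of excess < a has maximal length, and one of coexcess ≤ a + 1 minimal
-- length, among all factorisations of s. The triples (λ, μ, η) of the statement have both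
-- properties, so their value s has a single length, and so does every x with s - x ∈ S:
-- s avoids UBetti(S). Conversely B₁ = (k+2) a = (a+1) + k (a+2) and
-- B₂ = (k+1) (a+2) = (k+1) a + (a+1) have exactly these two factorisations (one extremal of
-- each kind, with disjoint supports), so they lie in UBetti(S); after trading 2 (a+1) for
-- a + (a+2), every factorisation of any other s dominates one of these four.

module Submission where

open import Defs
open import Data.Nat
  using (ℕ; zero; suc; _+_; _*_; _∸_; _<_; _≤_; _/_; _%_; z≤n; s≤s; s≤s⁻¹; _≤?_; _<?_)
open import Data.Nat.Properties
open import Data.Nat.DivMod using (m≡m%n+[m/n]*n; m*n/n≡m)
open import Data.Nat.Tactic.RingSolver using (solve-∀)
open import Data.Product using (∃; _×_; _,_)
open import Data.Sum using (_⊎_; inj₁; inj₂)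
open import Relation.Nullary using (¬_; yes; no; contradiction)
open import Relation.Binary.PropositionalEquality
open import Function.Bundles using (_⇔_; mk⇔; Equivalence)

excess : ℕ³ → ℕ
excess (x , y , z) = y + 2 * z

mirror : ℕ³ → ℕ³
mirror (x , y , z) = (z , y , x)

coexcess : ℕ³ → ℕ
coexcess α = excess (mirror α)

_⊕_ : ℕ³ → ℕ³ → ℕ³
(x , y , z) ⊕ (x′ , y′ , z′) = (x + x′ , y + y′ , z + z′)

len-mirror : ∀ α → len (mirror α) ≡ len α
len-mirror (x , y , z) = identity x y z
  where
  identity : ∀ x y z → z + y + x ≡ x + y + z
  identity = solve-∀

len-⊕ : ∀ α β → len (α ⊕ β) ≡ len α + len β
len-⊕ (x , y , z) (x′ , y′ , z′) = identity x y z x′ y′ z′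
  where
  identity : ∀ x y z x′ y′ z′ → x + x′ + (y + y′) + (z + z′) ≡ x + y + z + (x′ + y′ + z′)
  identity = solve-∀

excess≤1⇒last≡0 : ∀ {x y z} → excess (x , y , z) ≤ 1 → z ≡ 0
excess≤1⇒last≡0 {z = zero} _ = refl
excess≤1⇒last≡0 {y = y} {z = suc z} excess≤1
  with ≤-trans (≤-trans (*-monoʳ-≤ 2 (s≤s z≤n)) (m≤n+m (2 * suc z) y)) excess≤1
... | s≤s ()

small-excess-injective : ∀ {α β} →
  len α ≡ len β → excess α ≡ excess β → excess β ≤ 1 → α ≡ β
small-excess-injective {x , y , z} {x′ , y′ , z′} same-len same-excess excessβ≤1
  with refl ← excess≤1⇒last≡0 {x′} {y′} {z′} excessβ≤1
  with refl ← excess≤1⇒last≡0 {x} {y} {z} (subst (_≤ 1) (sym same-excess) excessβ≤1)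
  with refl ← +-cancelʳ-≡ 0 y y′ same-excess
  with refl ← +-cancelʳ-≡ y x x′ (+-cancelʳ-≡ 0 (x + y) (x′ + y) same-len) = refl

small-coexcess-injective : ∀ {α β} →
  len α ≡ len β → coexcess α ≡ coexcess β → coexcess β ≤ 1 → α ≡ β
small-coexcess-injective {α@(_ , _ , _)} {β@(_ , _ , _)} same-len same-coexcess coexcessβ≤1 =
  cong mirror (small-excess-injective same-mirrored-len same-coexcess coexcessβ≤1)
  where
  same-mirrored-len : len (mirror α) ≡ len (mirror β)
  same-mirrored-len = trans (len-mirror α) (trans same-len (sym (len-mirror β)))

module _ (a : ℕ) where

  eval≡len*a+excess : ∀ α → eval a α ≡ len α * a + excess α
  eval≡len*a+excess (x , y , z) = identity a x y z
    where
    identity : ∀ a x y z → x * a + y * (a + 1) + z * (a + 2) ≡ (x + y + z) * a + (y + 2 * z)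
    identity = solve-∀

  eval+coexcess≡len*[a+2] : ∀ α → eval a α + coexcess α ≡ len α * (a + 2)
  eval+coexcess≡len*[a+2] (x , y , z) = identity a x y z
    where
    identity : ∀ a x y z →
      x * a + y * (a + 1) + z * (a + 2) + (y + 2 * x) ≡ (x + y + z) * (a + 2)
    identity = solve-∀

  eval-⊕ : ∀ α β → eval a (α ⊕ β) ≡ eval a α + eval a β
  eval-⊕ (x , y , z) (x′ , y′ , z′) = identity a x y z x′ y′ z′
    where
    identity : ∀ a x y z x′ y′ z′ →
      (x + x′) * a + (y + y′) * (a + 1) + (z + z′) * (a + 2) ≡
      (x * a + y * (a + 1) + z * (a + 2)) + (x′ * a + y′ * (a + 1) + z′ * (a + 2))
    identity = solve-∀

  len-≤ : ∀ α β → eval a α ≡ eval a β → excess β < a → len α ≤ len β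
  len-≤ α β α~β excessβ<a = ≮⇒≥ λ lenβ<lenα → <-irrefl refl (begin-strict
    eval a β              ≡⟨ eval≡len*a+excess β ⟩
    len β * a + excess β  <⟨ +-monoʳ-< (len β * a) excessβ<a ⟩
    len β * a + a         ≡⟨ +-comm (len β * a) a ⟩
    suc (len β) * a       ≤⟨ *-monoˡ-≤ a lenβ<lenα ⟩
    len α * a             ≤⟨ m≤m+n (len α * a) (excess α) ⟩
    len α * a + excess α  ≡⟨ sym (eval≡len*a+excess α) ⟩
    eval a α              ≡⟨ α~β ⟩
    eval a β              ∎)
    where open ≤-Reasoning

  len-≥ : ∀ α β → eval a α ≡ eval a β → coexcess β ≤ a + 1 → len β ≤ len α
  len-≥ α β α~β coexcessβ≤a+1 = ≮⇒≥ λ lenα<lenβ → <-irrefl refl (begin-strict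
    suc (len α) * (a + 2)            ≤⟨ *-monoˡ-≤ (a + 2) lenα<lenβ ⟩
    len β * (a + 2)                  ≡⟨ sym (eval+coexcess≡len*[a+2] β) ⟩
    eval a β + coexcess β            ≤⟨ +-monoʳ-≤ (eval a β) coexcessβ≤a+1 ⟩
    eval a β + (a + 1)               ≡⟨ cong (_+ (a + 1)) (sym α~β) ⟩
    eval a α + (a + 1)               ≤⟨ +-monoˡ-≤ (a + 1) (m≤m+n (eval a α) (coexcess α)) ⟩
    eval a α + coexcess α + (a + 1)  ≡⟨ cong (_+ (a + 1)) (eval+coexcess≡len*[a+2] α) ⟩
    len α * (a + 2) + (a + 1)        ≡⟨ +-comm (len α * (a + 2)) (a + 1) ⟩
    (a + 1) + len α * (a + 2)        <⟨ +-monoˡ-< (len α * (a + 2)) (+-monoʳ-< a (n<1+n 1)) ⟩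
    suc (len α) * (a + 2)            ∎)
    where open ≤-Reasoning

  excess-≡ : ∀ α β → eval a α ≡ eval a β → len α ≡ len β → excess α ≡ excess β
  excess-≡ α β α~β same-len = +-cancelˡ-≡ (len α * a) (excess α) (excess β) (begin
    len α * a + excess α  ≡⟨ sym (eval≡len*a+excess α) ⟩
    eval a α              ≡⟨ α~β ⟩
    eval a β              ≡⟨ eval≡len*a+excess β ⟩
    len β * a + excess β  ≡⟨ cong (λ n → n * a + excess β) (sym same-len) ⟩
    len α * a + excess β  ∎)
    where open ≡-Reasoning

  coexcess-≡ : ∀ α β → eval a α ≡ eval a β → len α ≡ len β → coexcess α ≡ coexcess β
  coexcess-≡ α β α~β same-len = +-cancelˡ-≡ (eval a α) (coexcess α) (coexcess β) (begin
    eval a α + coexcess α  ≡⟨ eval+coexcess≡len*[a+2] α ⟩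
    len α * (a + 2)        ≡⟨ cong (_* (a + 2)) same-len ⟩
    len β * (a + 2)        ≡⟨ sym (eval+coexcess≡len*[a+2] β) ⟩
    eval a β + coexcess β  ≡⟨ cong (_+ coexcess β) (sym α~β) ⟩
    eval a α + coexcess β  ∎)
    where open ≡-Reasoning

  factorisations-of-two-lengths : ∀ {r} α β γ → 1 < a → IsFact a r β → IsFact a r γ →
    len β ≡ suc (len γ) → excess β ≤ 1 → coexcess γ ≤ 1 → IsFact a r α → α ≡ β ⊎ α ≡ γ
  factorisations-of-two-lengths α β γ 1<a fβ fγ lenβ≡1+lenγ excessβ≤1 coexcessγ≤1 fα =
    by-length (m≤n⇒m<n∨m≡n (len-≤ α β α~β (≤-<-trans excessβ≤1 1<a)))
    where
    α~β : eval a α ≡ eval a β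
    α~β = trans fα (sym fβ)

    α~γ : eval a α ≡ eval a γ
    α~γ = trans fα (sym fγ)

    by-length : len α < len β ⊎ len α ≡ len β → α ≡ β ⊎ α ≡ γ
    by-length (inj₂ lenα≡lenβ) =
      inj₁ (small-excess-injective lenα≡lenβ (excess-≡ α β α~β lenα≡lenβ) excessβ≤1)
    by-length (inj₁ lenα<lenβ) =
      inj₂ (small-coexcess-injective lenα≡lenγ (coexcess-≡ α γ α~γ lenα≡lenγ) coexcessγ≤1)
      where
      lenα≡lenγ : len α ≡ len γ
      lenα≡lenγ = ≤-antisym (s≤s⁻¹ (subst (len α <_) lenβ≡1+lenγ lenα<lenβ))
                            (len-≥ α γ α~γ (≤-trans coexcessγ≤1 (m≤n+m 1 a)))

  Walk-invariant : ∀ {r} (P : ℕ³ → Set) → (∀ {β γ} → P β → IsFact a r γ → Adj β γ → P γ) →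
    ∀ {β γ} → Walk a r β γ → P β → P γ
  Walk-invariant P preserved here Pβ = Pβ
  Walk-invariant P preserved (step fγ adj walk) Pβ =
    Walk-invariant P preserved walk (preserved Pβ fγ adj)

  two-factorisations⇒UBetti : ∀ {r} β γ → IsFact a r β → IsFact a r γ →
    (∀ α → IsFact a r α → α ≡ β ⊎ α ≡ γ) → dot β γ ≡ 0 → len β ≢ len γ →
    InUBetti a r
  two-factorisations⇒UBetti {r} β γ fβ fγ only-β-γ β⊥γ lenβ≢lenγ =
    ((β , fβ) , disconnected) , not-ULF
    where
    stays-at-β : ∀ {δ ε} → δ ≡ β → IsFact a r ε → Adj δ ε → ε ≡ β
    stays-at-β refl fε adj with only-β-γ _ fε
    ... | inj₁ ε≡β = ε≡β
    ... | inj₂ refl = contradiction β⊥γ adj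

    disconnected : ¬ Connected a r
    disconnected connected =
      lenβ≢lenγ (sym (cong len
        (Walk-invariant (_≡ β) stays-at-β (connected β γ fβ fγ) refl)))

    not-ULF : ¬ InULF a r
    not-ULF (_ , ℓ , lengths) =
      lenβ≢lenγ (trans (Equivalence.to (lengths _) (β , fβ , refl))
                       (sym (Equivalence.to (lengths _) (γ , fγ , refl))))

  two-lengths⇒UBetti : ∀ {r} β γ → 1 < a → IsFact a r β → IsFact a r γ →
    len β ≡ suc (len γ) → excess β ≤ 1 → coexcess γ ≤ 1 → dot β γ ≡ 0 → InUBetti a r
  two-lengths⇒UBetti β γ 1<a fβ fγ lenβ≡1+lenγ excessβ≤1 coexcessγ≤1 β⊥γ =
    two-factorisations⇒UBetti β γ fβ fγ
      (λ α → factorisations-of-two-lengths α β γ 1<a fβ fγ lenβ≡1+lenγ excessβ≤1 coexcessγ≤1)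
      β⊥γ (λ lenβ≡lenγ → 1+n≢n (trans (sym lenβ≡1+lenγ) lenβ≡lenγ))

  LengthUnique : ℕ → Set
  LengthUnique s = ∀ β γ → IsFact a s β → IsFact a s γ → len β ≡ len γ

  small-excesses⇒LengthUnique : ∀ {s} α → IsFact a s α →
    excess α < a → coexcess α ≤ a + 1 → LengthUnique s
  small-excesses⇒LengthUnique {s} α fα excessα<a coexcessα≤a+1 β γ fβ fγ =
    trans (len≡lenα β fβ) (sym (len≡lenα γ fγ))
    where
    len≡lenα : ∀ β → IsFact a s β → len β ≡ len α
    len≡lenα β fβ = ≤-antisym (len-≤ β α β~α excessα<a) (len-≥ β α β~α coexcessα≤a+1)
      where
      β~α : eval a β ≡ eval a α
      β~α = trans fβ (sym fα)

  LengthUnique-summand : ∀ {x t} → InS a t → LengthUnique (x + t) → LengthUnique x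
  LengthUnique-summand {x} {t} (τ , fτ) unique β γ fβ fγ =
    +-cancelʳ-≡ (len τ) (len β) (len γ) (begin
      len β + len τ  ≡⟨ sym (len-⊕ β τ) ⟩
      len (β ⊕ τ)    ≡⟨ unique (β ⊕ τ) (γ ⊕ τ) (plus-τ β fβ) (plus-τ γ fγ) ⟩
      len (γ ⊕ τ)    ≡⟨ len-⊕ γ τ ⟩
      len γ + len τ  ∎)
    where
    open ≡-Reasoning
    plus-τ : ∀ δ → IsFact a x δ → IsFact a (x + t) (δ ⊕ τ)
    plus-τ δ fδ = trans (eval-⊕ δ τ) (cong₂ _+_ fδ fτ)

  LengthUnique⇒ULF : ∀ {s} → InS a s → LengthUnique s → InULF a s
  LengthUnique⇒ULF (α , fα) unique = (α , fα) , len α , λ n →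
    mk⇔ (λ { (β , fβ , refl) → unique β α fβ fα }) (λ n≡lenα → α , fα , sym n≡lenα)

  LengthUnique⇒∈Ap[UBetti] : ∀ {s} → InS a s → LengthUnique s → InAp a (InUBetti a) s
  LengthUnique⇒∈Ap[UBetti] s∈S unique =
    s∈S , λ { x ((x∈S , _) , x∉ULF) (t , t∈S , s≡x+t) → x∉ULF (LengthUnique⇒ULF x∈S
      (LengthUnique-summand t∈S (subst LengthUnique s≡x+t unique))) }

  ⊕-factorisation⇒∉Ap : ∀ {X s x} β γ → X x → IsFact a x β → IsFact a s (β ⊕ γ) →
    ¬ InAp a X s
  ⊕-factorisation⇒∉Ap {s = s} {x} β γ x∈X fβ fβ⊕γ (_ , avoids) =
    avoids x x∈X (eval a γ , (γ , refl) , (begin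
      s                    ≡⟨ sym fβ⊕γ ⟩
      eval a (β ⊕ γ)       ≡⟨ eval-⊕ β γ ⟩
      eval a β + eval a γ  ≡⟨ cong (_+ eval a γ) fβ ⟩
      x + eval a γ         ∎))
    where open ≡-Reasoning

  middle≤1-factorisation : ∀ x y z →
    ∃ λ p → ∃ λ μ → ∃ λ r → μ ≤ 1 × eval a (p , μ , r) ≡ eval a (x , y , z)
  middle≤1-factorisation x 0 z = x , 0 , z , z≤n , refl
  middle≤1-factorisation x 1 z = x , 1 , z , s≤s z≤n , refl
  middle≤1-factorisation x (suc (suc y)) z with middle≤1-factorisation (suc x) y (suc z)
  ... | p , μ , r , μ≤1 , e = p , μ , r , μ≤1 , trans e (trade a x y z)
    where
    trade : ∀ a x y z →
      (1 + x) * a + y * (a + 1) + (1 + z) * (a + 2) ≡ x * a + (2 + y) * (a + 1) + z * (a + 2)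
    trade = solve-∀

-- The triples (λ, μ, η) of the statement; for μ = 1 the bound η ≤ k ∸ 1 is stated as η < k.
data InBox (k : ℕ) : ℕ³ → Set where
  μ≡0 : ∀ {l η} → l ≤ 1 + k → η ≤ k → InBox k (l , 0 , η)
  μ≡1 : ∀ {l η} → l ≤ k → η < k → InBox k (l , 1 , η)

InBox⇔bounds : ∀ {k l μ η} → 1 ≤ k →
  InBox k (l , μ , η) ⇔ (μ ≤ 1 × l ≤ k + 1 ∸ μ × η ≤ k ∸ μ)
InBox⇔bounds {suc j} {l} (s≤s z≤n) = mk⇔ to from
  where
  to : ∀ {μ η} → InBox (suc j) (l , μ , η) → μ ≤ 1 × l ≤ suc j + 1 ∸ μ × η ≤ suc j ∸ μ
  to (μ≡0 l≤2+j η≤1+j) = z≤n , subst (l ≤_) (+-comm 1 (suc j)) l≤2+j , η≤1+j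
  to (μ≡1 l≤1+j η<1+j) = s≤s z≤n , subst (l ≤_) (+-comm 1 j) l≤1+j , s≤s⁻¹ η<1+j

  from : ∀ {μ η} → μ ≤ 1 × l ≤ suc j + 1 ∸ μ × η ≤ suc j ∸ μ → InBox (suc j) (l , μ , η)
  from (z≤n , l≤2+j , η≤1+j) = μ≡0 (subst (l ≤_) (+-comm (suc j) 1) l≤2+j) η≤1+j
  from (s≤s z≤n , l≤1+j , η≤j) = μ≡1 (subst (l ≤_) (+-comm j 1) l≤1+j) (s≤s η≤j)

InBox⇒small-excesses : ∀ {k α} → InBox k α →
  excess α < suc (2 * k) × coexcess α ≤ suc (2 * k) + 1
InBox⇒small-excesses {k} (μ≡0 l≤1+k η≤k) =
  s≤s (*-monoʳ-≤ 2 η≤k) , ≤-trans (*-monoʳ-≤ 2 l≤1+k) (≤-reflexive (identity k))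
  where
  identity : ∀ k → 2 * (1 + k) ≡ suc (2 * k) + 1
  identity = solve-∀
InBox⇒small-excesses {k} (μ≡1 l≤k η<k) =
  s≤s (*-monoʳ-< 2 η<k) , ≤-trans (s≤s (*-monoʳ-≤ 2 l≤k)) (m≤m+n (suc (2 * k)) 1)

module _ (k : ℕ) where

  private
    a : ℕ
    a = suc (2 * k)

    1<a : 1 ≤ k → 1 < a
    1<a 1≤k = s≤s (≤-trans 1≤k (m≤m+n k (k + 0)))

  InBox⇒∈Ap : ∀ {α} → InBox k α → InAp a (InUBetti a) (eval a α)
  InBox⇒∈Ap {α} box with excess<a , coexcess≤a+1 ← InBox⇒small-excesses box =
    LengthUnique⇒∈Ap[UBetti] a (α , refl)
      (small-excesses⇒LengthUnique a α refl excess<a coexcess≤a+1)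

  B₁ B₂ : ℕ
  B₁ = eval a (2 + k , 0 , 0)
  B₂ = eval a (0 , 0 , 1 + k)

  B₁-factorisation : IsFact a B₁ (0 , 1 , k)
  B₁-factorisation = identity k
    where
    identity : ∀ k → 0 * suc (2 * k) + 1 * (suc (2 * k) + 1) + k * (suc (2 * k) + 2)
                   ≡ (2 + k) * suc (2 * k) + 0 * (suc (2 * k) + 1) + 0 * (suc (2 * k) + 2)
    identity = solve-∀

  B₂-factorisation : IsFact a B₂ (1 + k , 1 , 0)
  B₂-factorisation = identity k
    where
    identity : ∀ k → (1 + k) * suc (2 * k) + 1 * (suc (2 * k) + 1) + 0 * (suc (2 * k) + 2)
                   ≡ 0 * suc (2 * k) + 0 * (suc (2 * k) + 1) + (1 + k) * (suc (2 * k) + 2)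
    identity = solve-∀

  B₁∈UBetti : 1 ≤ k → InUBetti a B₁
  B₁∈UBetti 1≤k =
    two-lengths⇒UBetti a (2 + k , 0 , 0) (0 , 1 , k) (1<a 1≤k) refl B₁-factorisation
      (cong (2 +_) (trans (+-identityʳ _) (+-identityʳ k))) z≤n ≤-refl
      (cong (λ n → n + 0 + 0) (*-zeroʳ k))

  B₂∈UBetti : 1 ≤ k → InUBetti a B₂
  B₂∈UBetti 1≤k =
    two-lengths⇒UBetti a (1 + k , 1 , 0) (0 , 0 , 1 + k) (1<a 1≤k) B₂-factorisation refl
      (cong suc (trans (+-identityʳ _) (+-comm k 1))) ≤-refl z≤n
      (cong (λ n → n + 0 + 0) (*-zeroʳ k))

  ∈Ap⇒InBox : ∀ {s} → 1 ≤ k → InAp a (InUBetti a) s → ∃ λ α → InBox k α × IsFact a s α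
  ∈Ap⇒InBox {s} 1≤k s∈Ap@(((x , y , z) , fα) , _) with middle≤1-factorisation a x y z
  ... | p , 0 , r , _ , e = classify₀ p r (trans e fα)
    where
    classify₀ : ∀ p r → IsFact a s (p , 0 , r) → ∃ λ α → InBox k α × IsFact a s α
    classify₀ p r f with p ≤? 1 + k | r ≤? k
    ... | yes p≤1+k | yes r≤k = (p , 0 , r) , μ≡0 p≤1+k r≤k , f
    ... | no p≰1+k | _ with d , refl ← m≤n⇒∃[o]m+o≡n (≰⇒> p≰1+k) = contradiction s∈Ap
      (⊕-factorisation⇒∉Ap a (2 + k , 0 , 0) (d , 0 , r) (B₁∈UBetti 1≤k) refl f)
    ... | yes _ | no r≰k with d , refl ← m≤n⇒∃[o]m+o≡n (≰⇒> r≰k) = contradiction s∈Ap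
      (⊕-factorisation⇒∉Ap a (0 , 0 , 1 + k) (p , 0 , d) (B₂∈UBetti 1≤k) refl f)
  ... | p , 1 , r , _ , e = classify₁ p r (trans e fα)
    where
    classify₁ : ∀ p r → IsFact a s (p , 1 , r) → ∃ λ α → InBox k α × IsFact a s α
    classify₁ p r f with p ≤? k | r <? k
    ... | yes p≤k | yes r<k = (p , 1 , r) , μ≡1 p≤k r<k , f
    ... | no p≰k | _ with d , refl ← m≤n⇒∃[o]m+o≡n (≰⇒> p≰k) = contradiction s∈Ap
      (⊕-factorisation⇒∉Ap a (1 + k , 1 , 0) (d , 0 , r) (B₂∈UBetti 1≤k) B₂-factorisation f)
    ... | yes _ | no r≮k with d , refl ← m≤n⇒∃[o]m+o≡n (≮⇒≥ r≮k) = contradiction s∈Ap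
      (⊕-factorisation⇒∉Ap a (0 , 1 , k) (p , 0 , d) (B₁∈UBetti 1≤k) B₁-factorisation f)
  ... | _ , suc (suc _) , _ , s≤s () , _

odd⇒≡1+2*k : ∀ {a} → a % 2 ≡ 1 → ∃ λ k → a ≡ suc (2 * k)
odd⇒≡1+2*k {a} a%2≡1 = a / 2 , (begin
  a                  ≡⟨ m≡m%n+[m/n]*n a 2 ⟩
  a % 2 + a / 2 * 2  ≡⟨ cong₂ _+_ a%2≡1 (*-comm (a / 2) 2) ⟩
  suc (2 * (a / 2))  ∎)
  where open ≡-Reasoning

2*k/2≡k : ∀ k → 2 * k / 2 ≡ k
2*k/2≡k k = trans (cong (_/ 2) (*-comm 2 k)) (m*n/n≡m k 2)

lemma5p2 : (a : ℕ) → a % 2 ≡ 1 → 2 < a → (s : ℕ) →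
    InAp a (InUBetti a) s ⇔
      (∃ λ μ → ∃ λ l → ∃ λ η → μ ≤ 1 × l ≤ (a ∸ 1) / 2 + 1 ∸ μ × η ≤ (a ∸ 1) / 2 ∸ μ
        × s ≡ l * a + μ * (a + 1) + η * (a + 2))
lemma5p2 a a%2≡1 2<a s with k , refl ← odd⇒≡1+2*k {a} a%2≡1 rewrite 2*k/2≡k k = mk⇔
  (λ s∈Ap → let (l , μ , η) , box , f = ∈Ap⇒InBox k 1≤k s∈Ap
                μ≤1 , l≤ , η≤ = Equivalence.to (InBox⇔bounds 1≤k) box
            in μ , l , η , μ≤1 , l≤ , η≤ , sym f)
  (λ (μ , l , η , μ≤1 , l≤ , η≤ , s≡) → subst (InAp _ (InUBetti _)) (sym s≡)
    (InBox⇒∈Ap k (Equivalence.from (InBox⇔bounds 1≤k) (μ≤1 , l≤ , η≤))))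
  where
  1≤k : 1 ≤ k
  1≤k = *-cancelˡ-≤ 2 (s≤s⁻¹ 2<a)
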